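{- Let $G$ be a graph of order $n$. Then (1) $\overset{\rightarrow}{\Gamma}_{LD}(G)\geq\alpha(G)$; (2) $\overset{\rightarrow}{\Gamma}_{LD}(G)\geq\lceil\omega(G)/2\rceil$; (3) $\overset{\rightarrow}{\Gamma}_{LD}(G)\geq 2n/\lceil \mathrm{mad}(G)/2+3\rceil$.
   Context: $\alpha(G)$ is the independence number, $\omega(G)$ the clique number, and $\mathrm{mad}(G)$ the maximum average degree, i.e. the maximum of $2|E(H)|/|V(H)|$ over all subgraphs $H$ of $G$. For an orientation $D$ of $G=(V,E)$ (each edge given exactly one direction), $S\subseteq V$ is locating-dominating in $D$ if every $u\notin S$ has an in-neighbour in $S$ and distinct $u,v\notin S$ have distinct sets of in-neighbours in $S$; $\gamma_{LD}(D)$ is the minimum size. $\overset{\rightarrow}{\Gamma}_{LD}(G)=\max_D\gamma_{LD}(D)$ over all orientations $D$ of $G$. -}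

module Defs where

open import Data.Nat using (ℕ; zero; suc; _+_; _*_; _≤_; _<ᵇ_)
open import Data.Bool using (Bool; true; false; _∧_; if_then_else_)
open import Data.Fin using (Fin; toℕ)
open import Data.Fin.Subset using (Subset; _∈_; _∉_; ∣_∣)
open import Data.List using (List; map; allFin)
open import Data.Nat.ListAction using (sum)
open import Data.Product using (Σ; _×_; _,_; ∃-syntax)
open import Data.Sum using (_⊎_)
open import Relation.Nullary using (¬_)
open import Relation.Binary.PropositionalEquality using (_≡_; _≢_)

record Graph (n : ℕ) : Set where
  field
    adj    : Fin n → Fin n → Bool
    sym    : ∀ u v → adj u v ≡ adj v u
    irrefl : ∀ u → adj u u ≡ false
open Graph public

record Orientation {n : ℕ} (G : Graph n) : Set where
  field
    arc      : Fin n → Fin n → Bool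
    arc-edge : ∀ u v → arc u v ≡ true → adj G u v ≡ true
    edge-arc : ∀ u v → adj G u v ≡ true → (arc u v ≡ true) ⊎ (arc v u ≡ true)
    one-dir  : ∀ u v → ¬ ((arc u v ≡ true) × (arc v u ≡ true))
open Orientation public

-- S is locating-dominating in D (arc w u = w is an in-neighbour of u).
IsLocDom : {n : ℕ} {G : Graph n} → Orientation G → Subset n → Set
IsLocDom {n} D S =
  (∀ u → u ∉ S → ∃[ w ] (w ∈ S × arc D w u ≡ true)) ×
  (∀ u v → u ∉ S → v ∉ S → u ≢ v → ∃[ w ] (w ∈ S × arc D w u ≢ arc D w v))

IsGammaLD : {n : ℕ} {G : Graph n} → Orientation G → ℕ → Set
IsGammaLD {n} D g =
  (∃[ S ] (IsLocDom D S × ∣ S ∣ ≡ g)) × (∀ S → IsLocDom D S → g ≤ ∣ S ∣)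

IsOrientedGammaLD : {n : ℕ} → Graph n → ℕ → Set
IsOrientedGammaLD G Γ =
  (∃[ D ] IsGammaLD {G = G} D Γ) × (∀ D g → IsGammaLD {G = G} D g → g ≤ Γ)

IsIndependent : {n : ℕ} → Graph n → Subset n → Set
IsIndependent G S = ∀ u v → u ∈ S → v ∈ S → adj G u v ≡ false

IsClique : {n : ℕ} → Graph n → Subset n → Set
IsClique G S = ∀ u v → u ∈ S → v ∈ S → u ≢ v → adj G u v ≡ true

IsIndependenceNumber : {n : ℕ} → Graph n → ℕ → Set
IsIndependenceNumber G a =
  (∃[ S ] (IsIndependent G S × ∣ S ∣ ≡ a)) × (∀ S → IsIndependent G S → ∣ S ∣ ≤ a)

IsCliqueNumber : {n : ℕ} → Graph n → ℕ → Set
IsCliqueNumber G w =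
  (∃[ S ] (IsClique G S × ∣ S ∣ ≡ w)) × (∀ S → IsClique G S → ∣ S ∣ ≤ w)

edgeCount : {n : ℕ} → (Fin n → Fin n → Bool) → ℕ
edgeCount {n} e =
  sum (map (λ i → sum (map (λ j → if (toℕ i <ᵇ toℕ j) ∧ e i j then 1 else 0) (allFin n))) (allFin n))

IsSubgraph : {n : ℕ} → Graph n → Subset n → (Fin n → Fin n → Bool) → Set
IsSubgraph G S E =
  (∀ u v → E u v ≡ E v u) ×
  (∀ u v → E u v ≡ true → (adj G u v ≡ true) × (u ∈ S) × (v ∈ S))

-- c is an upper bound of mad(G)/2 + 3, i.e. for every nonempty subgraph H,
-- (2|E(H)|/|V(H)|)/2 + 3 ≤ c, written without division as |E(H)| + 3|V(H)| ≤ c|V(H)|.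
MadHalfPlus3Bound : {n : ℕ} → Graph n → ℕ → Set
MadHalfPlus3Bound G c =
  ∀ S E → IsSubgraph G S E → 1 ≤ ∣ S ∣ → edgeCount E + 3 * ∣ S ∣ ≤ c * ∣ S ∣

IsCeilMadHalfPlus3 : {n : ℕ} → Graph n → ℕ → Set
IsCeilMadHalfPlus3 G c =
  MadHalfPlus3Bound G c × (∀ c' → MadHalfPlus3Bound G c' → c ≤ c')

{-# OPTIONS --safe #-}
-- (1) Orient every edge away from a maximum independent set I: the vertices of I become sources,
-- and a locating-dominating set must contain every source.
-- (2) Orient a maximum clique K by index and everything else away from it. For a
-- locating-dominating set S, each vertex of K ∖ S has an in-neighbour in K ∩ S below it, and two
-- vertices of K ∖ S are separated by a vertex of K ∩ S lying between them; so |K ∖ S| ≤ |K ∩ S|.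
-- (3) By Hakimi's theorem, proved by reversing shortest walks in an orientation of least excess
-- out-degree, G has an orientation with all out-degrees at most k = ⌈mad(G)/2⌉. Every vertex
-- outside S has an in-neighbour in S, and those with exactly one are distinguished by it, so
-- 2(n − |S|) ≤ k|S| + |S|.
module Submission where

open import Defs renaming (sym to adj-sym)
open import Data.Bool using (Bool; true; false; _∧_; if_then_else_; T)
open import Data.Bool.Properties using (T-≡; ∧-zeroʳ; ∧-identityʳ; ∧-comm)
import Data.Bool as Bool
open import Data.Empty using (⊥; ⊥-elim)
open import Data.Fin using (Fin; toℕ) renaming (zero to fzero; suc to fsuc)
open import Data.Fin.Properties using (_≟_)
import Data.Fin.Properties as Fin
open import Data.Fin.Subset using (Subset; _∈_; _∉_; ∣_∣; ⊤)
open import Data.Fin.Subset.Properties using (_∈?_; ∈⊤; ∣⊤∣≡n; p⊆q⇒∣p∣≤∣q∣; drop-there)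
open import Data.Nat using (ℕ; zero; suc; _+_; _*_; _∸_; _≤_; _<_; z≤n; s≤s; _<ᵇ_; _/_)
open import Data.Nat.DivMod using (m<n*o⇒m/o<n)
open import Data.Nat.Induction using (<-rec)
open import Data.Nat.Properties renaming (_≟_ to _≟ℕ_)
open import Data.Nat.Tactic.RingSolver using (solve-∀)
open import Data.Sum using (_⊎_; inj₁; inj₂; [_,_]′)
open import Data.Product using (_×_; _,_; ∃-syntax; proj₁; proj₂)
import Data.List as List using (map; allFin; tabulate)
open import Data.List.Properties using (map-tabulate)
import Data.Nat.ListAction as List
open import Data.Vec using (_∷_; []; here; there)
open import Function using (_∘_; Equivalence)
open import Relation.Nullary using (¬_; Dec; yes; no; does; contradiction)
open import Relation.Nullary.Decidable using (dec-true; dec-false; ¬?; _×-dec_; _→-dec_; decidable-stable; ¬¬-excluded-middle; _⊎-dec_)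
open import Relation.Binary.Definitions using (tri<; tri≈; tri>)
open import Relation.Binary.PropositionalEquality

open import Algebra.Properties.Semiring.Sum +-*-semiring
  using (sum; sum-syntax; ∑-distrib-+; ∑-comm; *-distribˡ-sum; sum-cong-≗)

𝟙 : Bool → ℕ
𝟙 b = if b then 1 else 0

⟦_⟧ : {A : Set} → Dec A → ℕ
⟦ a? ⟧ = 𝟙 (does a?)

⟦yes⟧ : {A : Set} (a? : Dec A) → A → ⟦ a? ⟧ ≡ 1
⟦yes⟧ a? a = cong 𝟙 (dec-true a? a)

⟦no⟧ : {A : Set} (a? : Dec A) → ¬ A → ⟦ a? ⟧ ≡ 0
⟦no⟧ a? ¬a = cong 𝟙 (dec-false a? ¬a)

∧-true : ∀ {a b} → a ∧ b ≡ true → a ≡ true × b ≡ true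
∧-true {true} {true} _ = refl , refl

<ᵇ-true⇒< : ∀ {m n} → (m <ᵇ n) ≡ true → m < n
<ᵇ-true⇒< {m} {n} m<ᵇn = <ᵇ⇒< m n (subst T (sym m<ᵇn) _)

<⇒<ᵇ-true : ∀ {m n} → m < n → (m <ᵇ n) ≡ true
<⇒<ᵇ-true m<n = Equivalence.to T-≡ (<⇒<ᵇ m<n)

Bool-≢ : ∀ {b b'} → b ≢ b' → (b ≡ true × b' ≡ false) ⊎ (b ≡ false × b' ≡ true)
Bool-≢ {true}  {true}  b≢b' = contradiction refl b≢b'
Bool-≢ {true}  {false} _    = inj₁ (refl , refl)
Bool-≢ {false} {true}  _    = inj₂ (refl , refl)
Bool-≢ {false} {false} b≢b' = contradiction refl b≢b'

does⇒ : {A : Set} (a? : Dec A) → does a? ≡ true → A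
does⇒ (yes a) _ = a

<ᵇ-flip : ∀ {m n} → m ≢ n → (n <ᵇ m) ≡ Bool.not (m <ᵇ n)
<ᵇ-flip {zero}  {zero}  m≢n = contradiction refl m≢n
<ᵇ-flip {zero}  {suc n} _   = refl
<ᵇ-flip {suc m} {zero}  _   = refl
<ᵇ-flip {suc m} {suc n} m≢n = <ᵇ-flip (m≢n ∘ cong suc)

𝟙-merge : ∀ l c {a b e} → 𝟙 a + 𝟙 b ≡ 𝟙 e → 𝟙 (l ∧ (a ∧ c)) + 𝟙 (l ∧ (b ∧ c)) ≡ 𝟙 (l ∧ (e ∧ c))
𝟙-merge false _     _ = refl
𝟙-merge true  false {a} {b} {e} _ rewrite ∧-zeroʳ a | ∧-zeroʳ b | ∧-zeroʳ e = refl
𝟙-merge true  true  {a} {b} {e} a+b≡e rewrite ∧-identityʳ a | ∧-identityʳ b | ∧-identityʳ e = a+b≡e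

sum-mono-≤ : ∀ {n} {f g : Fin n → ℕ} → (∀ i → f i ≤ g i) → sum f ≤ sum g
sum-mono-≤ {zero}  f≤g = z≤n
sum-mono-≤ {suc n} f≤g = +-mono-≤ (f≤g fzero) (sum-mono-≤ (f≤g ∘ fsuc))

term≤sum : ∀ {n} (f : Fin n → ℕ) i → f i ≤ sum f
term≤sum f fzero    = m≤m+n (f fzero) _
term≤sum f (fsuc i) = ≤-trans (term≤sum (f ∘ fsuc) i) (m≤n+m _ (f fzero))

sum-zero : ∀ {n} {f : Fin n → ℕ} → (∀ i → f i ≡ 0) → sum f ≡ 0
sum-zero {zero}  f≡0 = refl
sum-zero {suc n} f≡0 = cong₂ _+_ (f≡0 fzero) (sum-zero (f≡0 ∘ fsuc))

sum-ones : ∀ n → ∑[ i < n ] 1 ≡ n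
sum-ones zero    = refl
sum-ones (suc n) = cong suc (sum-ones n)

∑∑-distrib-+ : ∀ {n m} (f g : Fin n → Fin m → ℕ) →
  ∑[ i < n ] ∑[ j < m ] (f i j + g i j) ≡ ∑[ i < n ] ∑[ j < m ] f i j + ∑[ i < n ] ∑[ j < m ] g i j
∑∑-distrib-+ f g = trans (sum-cong-≗ (λ i → ∑-distrib-+ (f i) (g i)))
                         (∑-distrib-+ (λ i → ∑[ j < _ ] f i j) (λ i → ∑[ j < _ ] g i j))

sum-map-allFin : ∀ {n} (f : Fin n → ℕ) → List.sum (List.map f (List.allFin n)) ≡ ∑[ i < n ] f i
sum-map-allFin {n} f = trans (cong List.sum (map-tabulate (λ i → i) f)) (sum-tabulate f)
  where
  sum-tabulate : ∀ {m} (g : Fin m → ℕ) → List.sum (List.tabulate g) ≡ ∑[ i < m ] g i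
  sum-tabulate {zero}  g = refl
  sum-tabulate {suc m} g = cong (g fzero +_) (sum-tabulate (g ∘ fsuc))

count : ∀ {n} {P : Fin n → Set} → (∀ i → Dec (P i)) → ℕ
count {n} P? = ∑[ i < n ] ⟦ P? i ⟧

module _ {n : ℕ} {P : Fin n → Set} (P? : ∀ i → Dec (P i)) where

  count≥1 : ∀ i → P i → 1 ≤ count P?
  count≥1 i p = subst (_≤ count P?) (⟦yes⟧ (P? i) p) (term≤sum _ i)

  count≡0 : (∀ i → ¬ P i) → count P? ≡ 0
  count≡0 none = sum-zero (λ i → ⟦no⟧ (P? i) (none i))

  count-mono : {Q : Fin n → Set} (Q? : ∀ i → Dec (Q i)) → (∀ i → P i → Q i) → count P? ≤ count Q?
  count-mono Q? P⇒Q = sum-mono-≤ pointwise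
    where
    pointwise : ∀ i → ⟦ P? i ⟧ ≤ ⟦ Q? i ⟧
    pointwise i with P? i
    ... | no _  = z≤n
    ... | yes p = ≤-reflexive (sym (⟦yes⟧ (Q? i) (P⇒Q i p)))

count≤1 : ∀ {n} {P : Fin n → Set} (P? : ∀ i → Dec (P i)) →
          (∀ i j → P i → P j → i ≡ j) → count P? ≤ 1
count≤1 {zero}  P? unique = z≤n
count≤1 {suc n} P? unique with P? fzero
... | yes p = ≤-reflexive (cong suc (count≡0 (P? ∘ fsuc) (λ i q → Fin.0≢1+n (unique fzero (fsuc i) p q))))
... | no _  = count≤1 (P? ∘ fsuc) (λ i j p q → Fin.suc-injective (unique (fsuc i) (fsuc j) p q))

count-≟ : ∀ {n} (j : Fin n) → count (_≟ j) ≡ 1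
count-≟ j = ≤-antisym (count≤1 (_≟ j) (λ i k i≡j k≡j → trans i≡j (sym k≡j)))
                      (count≥1 (_≟ j) j refl)

count≥2 : ∀ {n} {P : Fin n → Set} (P? : ∀ i → Dec (P i)) →
          ∀ i j → P i → P j → i ≢ j → 2 ≤ count P?
count≥2 P? fzero    fzero    p q i≢j = contradiction refl i≢j
count≥2 P? fzero    (fsuc j) p q _ rewrite ⟦yes⟧ (P? fzero) p = s≤s (count≥1 (P? ∘ fsuc) j q)
count≥2 P? (fsuc i) fzero    p q _ rewrite ⟦yes⟧ (P? fzero) q = s≤s (count≥1 (P? ∘ fsuc) i p)
count≥2 P? (fsuc i) (fsuc j) p q i≢j =
  ≤-trans (count≥2 (P? ∘ fsuc) i j p q (i≢j ∘ cong fsuc)) (m≤n+m _ _)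

count≤1⇒unique : ∀ {n} {P : Fin n → Set} (P? : ∀ i → Dec (P i)) → count P? ≤ 1 →
                 ∀ {i j} → P i → P j → i ≡ j
count≤1⇒unique P? atMostOne {i} {j} p q with i ≟ j
... | yes i≡j = i≡j
... | no i≢j  = contradiction (count≥2 P? i j p q i≢j) (<⇒≱ (s≤s atMostOne))

∣p∣≡count : ∀ {n} (p : Subset n) → ∣ p ∣ ≡ count (_∈? p)
∣p∣≡count []            = refl
∣p∣≡count (true  ∷ p) = cong suc (∣p∣≡count p)
∣p∣≡count (false ∷ p) = ∣p∣≡count p

count-split : ∀ {n} {P Q : Fin n → Set} (P? : ∀ i → Dec (P i)) (Q? : ∀ i → Dec (Q i)) →
              count P? ≡ count (λ i → P? i ×-dec Q? i) + count (λ i → P? i ×-dec ¬? (Q? i))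
count-split P? Q? =
  trans (sum-cong-≗ pointwise) (∑-distrib-+ (λ i → ⟦ P? i ×-dec Q? i ⟧) (λ i → ⟦ P? i ×-dec ¬? (Q? i) ⟧))
  where
  pointwise : ∀ i → ⟦ P? i ⟧ ≡ ⟦ P? i ×-dec Q? i ⟧ + ⟦ P? i ×-dec ¬? (Q? i) ⟧
  pointwise i with P? i | Q? i
  ... | yes _ | yes _ = refl
  ... | yes _ | no _  = refl
  ... | no _  | _     = refl

count+count-complement : ∀ {n} {P : Fin n → Set} (P? : ∀ i → Dec (P i)) →
                         count P? + count (¬? ∘ P?) ≡ n
count+count-complement {n} P? =
  trans (sym (∑-distrib-+ (λ i → ⟦ P? i ⟧) (λ i → ⟦ ¬? (P? i) ⟧))) (trans (sum-cong-≗ pointwise) (sum-ones n))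
  where
  pointwise : ∀ i → ⟦ P? i ⟧ + ⟦ ¬? (P? i) ⟧ ≡ 1
  pointwise i with P? i
  ... | yes _ = refl
  ... | no _  = refl

count-≤-matching : ∀ {n m} {A : Fin n → Set} {B : Fin m → Set} {R : Fin n → Fin m → Set}
  (A? : ∀ v → Dec (A v)) (B? : ∀ w → Dec (B w)) (R? : ∀ v w → Dec (R v w)) →
  (∀ v → A v → ∃[ w ] R v w) → (∀ v w → R v w → B w) → (∀ v v' w → R v w → R v' w → v ≡ v') →
  count A? ≤ count B?
count-≤-matching {n} {m} {R = R} A? B? R? total into injective = begin
  ∑[ v < n ] ⟦ A? v ⟧               ≤⟨ sum-mono-≤ matched ⟩
  ∑[ v < n ] ∑[ w < m ] ⟦ R? v w ⟧  ≡⟨ ∑-comm (λ v w → ⟦ R? v w ⟧) ⟩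
  ∑[ w < m ] ∑[ v < n ] ⟦ R? v w ⟧  ≤⟨ sum-mono-≤ matchedOnce ⟩
  ∑[ w < m ] ⟦ B? w ⟧               ∎
  where
  open ≤-Reasoning
  matched : ∀ v → ⟦ A? v ⟧ ≤ count (R? v)
  matched v with A? v
  ... | no _  = z≤n
  ... | yes a = count≥1 (R? v) _ (proj₂ (total v a))
  matchedOnce : ∀ w → count (λ v → R? v w) ≤ ⟦ B? w ⟧
  matchedOnce w with B? w
  ... | yes _ = count≤1 (λ v → R? v w) (λ v v' r r' → injective v v' w r r')
  ... | no ¬b = ≤-reflexive (count≡0 (λ v → R? v w) (λ v r → ¬b (into v w r)))

greatest? : ∀ {n} {Q : Fin n → Set} → (∀ i → Dec (Q i)) →
            (∀ i → ¬ Q i) ⊎ ∃[ w ] (Q w × ∀ i → Q i → toℕ i ≤ toℕ w)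
greatest? {zero}  Q? = inj₁ (λ ())
greatest? {suc n} {Q} Q? with greatest? (Q? ∘ fsuc) | Q? fzero
... | inj₂ (w , qw , max) | _ = inj₂ (fsuc w , qw , bound)
  where
  bound : ∀ i → Q i → toℕ i ≤ toℕ (fsuc w)
  bound fzero    _ = z≤n
  bound (fsuc i) q = s≤s (max i q)
... | inj₁ none | yes q₀ = inj₂ (fzero , q₀ , bound)
  where
  bound : ∀ i → Q i → toℕ i ≤ 0
  bound fzero    _ = z≤n
  bound (fsuc i) q = contradiction q (none i)
... | inj₁ none | no ¬q₀ = inj₁ λ { fzero → ¬q₀ ; (fsuc i) → none i }

-- Match every a ∈ A with the greatest element of T below it.
count-≤-interleaved : ∀ {n} {A T : Fin n → Set} (A? : ∀ i → Dec (A i)) (T? : ∀ i → Dec (T i)) →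
  (∀ a → A a → ∃[ t ] (T t × toℕ t < toℕ a)) →
  (∀ a a' → A a → A a' → toℕ a < toℕ a' → ∃[ t ] (T t × toℕ a ≤ toℕ t × toℕ t < toℕ a')) →
  count A? ≤ count T?
count-≤-interleaved {n} {A} {T} A? T? below between =
  count-≤-matching A? T? R? total (λ _ _ r → proj₁ (proj₂ r)) injective
  where
  R : Fin n → Fin n → Set
  R a t = A a × T t × toℕ t < toℕ a × (∀ x → T x → toℕ x < toℕ a → toℕ x ≤ toℕ t)
  R? : ∀ a t → Dec (R a t)
  R? a t = A? a ×-dec T? t ×-dec toℕ t <? toℕ a ×-dec
           Fin.all? (λ x → T? x →-dec toℕ x <? toℕ a →-dec toℕ x ≤? toℕ t)
  total : ∀ a → A a → ∃[ t ] R a t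
  total a aA with greatest? (λ x → T? x ×-dec toℕ x <? toℕ a)
  ... | inj₁ none = let (t , tT , t<a) = below a aA in contradiction (tT , t<a) (none t)
  ... | inj₂ (t , (tT , t<a) , max) = t , aA , tT , t<a , λ x xT x<a → max x (xT , x<a)
  ordered : ∀ a a' t → toℕ a < toℕ a' → R a t → R a' t → ⊥
  ordered a a' t a<a' (aA , _ , t<a , _) (a'A , _ , _ , max') =
    let (t' , t'T , a≤t' , t'<a') = between a a' aA a'A a<a'
    in <⇒≱ (<-≤-trans t<a a≤t') (max' t' t'T t'<a')
  injective : ∀ a a' t → R a t → R a' t → a ≡ a'
  injective a a' t r r' with <-cmp (toℕ a) (toℕ a')
  ... | tri< a<a' _ _ = ⊥-elim (ordered a a' t a<a' r r')
  ... | tri≈ _ a≡a' _ = Fin.toℕ-injective a≡a'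
  ... | tri> _ _ a'<a = ⊥-elim (ordered a' a t a'<a r' r)

LeastWitness : (ℕ → Set) → Set
LeastWitness P = ∃[ m ] (P m × ∀ j → j < m → ¬ P j)

¬¬-least : {P : ℕ → Set} → ∀ k → P k → ¬ ¬ LeastWitness P
¬¬-least {P} = <-rec (λ k → P k → ¬ ¬ LeastWitness P) step
  where
  step : ∀ k → (∀ {j} → j < k → P j → ¬ ¬ LeastWitness P) → P k → ¬ ¬ LeastWitness P
  step k smaller pk ¬least = ¬¬-excluded-middle {A = ∃[ j ] (j < k × P j)} λ where
    (yes (j , j<k , pj)) → smaller j<k pj ¬least
    (no none)            → ¬least (k , pk , λ j j<k pj → none (j , j<k , pj))

_Represents_ : ∀ {n} → Subset n → (Fin n → Set) → Set
R Represents P = ∀ i → (i ∈ R → P i) × (P i → i ∈ R)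

¬¬-subset : ∀ {n} (P : Fin n → Set) → ¬ ¬ (∃[ R ] R Represents P)
¬¬-subset {zero}  P k = k ([] , λ ())
¬¬-subset {suc n} P k = ¬¬-excluded-middle {A = P fzero} λ P₀? → ¬¬-subset (P ∘ fsuc) λ (R , R⇔P) → k (extend P₀? R R⇔P)
  where
  extend : Dec (P fzero) → (R : Subset n) → R Represents (P ∘ fsuc) → ∃[ R' ] R' Represents P
  extend (yes p₀) R R⇔P = (true ∷ R) , λ where
    fzero    → (λ _ → p₀) , (λ _ → here)
    (fsuc i) → proj₁ (R⇔P i) ∘ drop-there , there ∘ proj₂ (R⇔P i)
  extend (no ¬p₀) R R⇔P = (false ∷ R) , λ where
    fzero    → (λ ()) , (λ p₀ → contradiction p₀ ¬p₀)
    (fsuc i) → proj₁ (R⇔P i) ∘ drop-there , there ∘ proj₂ (R⇔P i)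

module _ {n} {G : Graph n} where

  ¬¬-γLD : (D : Orientation G) → ¬ ¬ (∃[ g ] IsGammaLD D g)
  ¬¬-γLD D ¬γ = ¬¬-least ∣ ⊤ {n} ∣ (⊤ , everything , refl) minimal
    where
    minimal : ¬ LeastWitness (λ m → ∃[ S ] (IsLocDom D S × ∣ S ∣ ≡ m))
    minimal (m , (S , ld , ∣S∣≡m) , least) =
      ¬γ (m , (S , ld , ∣S∣≡m) , λ S' ld' → ≮⇒≥ (λ ∣S'∣<m → least ∣ S' ∣ ∣S'∣<m (S' , ld' , refl)))
    everything : IsLocDom D (⊤ {n})
    everything = (λ u u∉⊤ → contradiction ∈⊤ u∉⊤) , (λ u v u∉⊤ → contradiction ∈⊤ u∉⊤)

  -- The orientation may be found classically: the conclusion is decidable.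
  Γ-lowerBound : ∀ {Γ m} → IsOrientedGammaLD G Γ → (f : ℕ → ℕ) → (∀ {a b} → a ≤ b → f a ≤ f b) →
                 ¬ ¬ (∃[ D ] ∀ S → IsLocDom D S → m ≤ f ∣ S ∣) → m ≤ f Γ
  Γ-lowerBound {Γ} {m} (_ , Γ-max) f f-mono ¬¬D = decidable-stable (m ≤? f Γ) λ m≰fΓ →
    ¬¬D λ (D , bound) → ¬¬-γLD D λ (g , γ@((S , ld , ∣S∣≡g) , _)) →
      m≰fΓ (≤-trans (bound S ld) (f-mono (subst (_≤ Γ) (sym ∣S∣≡g) (Γ-max D g γ))))

adj⇒≢ : ∀ {n} (G : Graph n) {u v} → adj G u v ≡ true → u ≢ v
adj⇒≢ G {u} uv refl = contradiction (trans (sym uv) (irrefl G u)) λ ()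

module _ {n} (G : Graph n) where

  byRank : (r : Fin n → ℕ) → (∀ {u v} → r u ≡ r v → u ≡ v) → Orientation G
  byRank r r-inj = record
    { arc      = λ u v → adj G u v ∧ (r u <ᵇ r v)
    ; arc-edge = λ u v uv → proj₁ (∧-true uv)
    ; edge-arc = edge-arc′
    ; one-dir  = λ u v (uv , vu) → <-asym {r u} {r v} (<ᵇ-true⇒< (proj₂ (∧-true {adj G u v} uv)))
                                              (<ᵇ-true⇒< (proj₂ (∧-true {adj G v u} vu)))
    }
    where
    edge-arc′ : ∀ u v → adj G u v ≡ true →
                (adj G u v ∧ (r u <ᵇ r v) ≡ true) ⊎ (adj G v u ∧ (r v <ᵇ r u) ≡ true)
    edge-arc′ u v uv with <-cmp (r u) (r v)
    ... | tri< ru<rv _ _ = inj₁ (cong₂ _∧_ uv (<⇒<ᵇ-true ru<rv))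
    ... | tri≈ _ ru≡rv _ = contradiction (r-inj ru≡rv) (adj⇒≢ G uv)
    ... | tri> _ _ rv<ru = inj₂ (cong₂ _∧_ (trans (adj-sym G v u) uv) (<⇒<ᵇ-true rv<ru))

  frontRank : Subset n → Fin n → ℕ
  frontRank S u = if does (u ∈? S) then toℕ u else n + toℕ u

  frontRank-injective : ∀ S {u v} → frontRank S u ≡ frontRank S v → u ≡ v
  frontRank-injective S {u} {v} ru≡rv with u ∈? S | v ∈? S
  ... | yes _ | yes _ = Fin.toℕ-injective ru≡rv
  ... | yes _ | no _  = contradiction ru≡rv (<⇒≢ (<-≤-trans (Fin.toℕ<n u) (m≤m+n n (toℕ v))))
  ... | no _  | yes _ = contradiction (sym ru≡rv) (<⇒≢ (<-≤-trans (Fin.toℕ<n v) (m≤m+n n (toℕ u))))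
  ... | no _  | no _  = Fin.toℕ-injective (+-cancelˡ-≡ n _ _ ru≡rv)

  frontRank-∈ : ∀ S {u} → u ∈ S → frontRank S u ≡ toℕ u
  frontRank-∈ S {u} u∈S rewrite dec-true (u ∈? S) u∈S = refl

  frontRank-< : ∀ S {w v} → frontRank S w < frontRank S v → v ∈ S → w ∈ S × toℕ w < toℕ v
  frontRank-< S {w} {v} rw<rv v∈S with w ∈? S | v ∈? S
  ... | yes w∈S | yes _ = w∈S , rw<rv
  ... | no _    | yes _ = contradiction rw<rv (<-asym (<-≤-trans (Fin.toℕ<n v) (m≤m+n n (toℕ w))))
  ... | _       | no v∉S = contradiction v∈S v∉S

  frontOrientation : Subset n → Orientation G
  frontOrientation S = byRank (frontRank S) (frontRank-injective S)

  frontOrientation-into : ∀ S {w v} → arc (frontOrientation S) w v ≡ true → v ∈ S →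
                          w ∈ S × toℕ w < toℕ v
  frontOrientation-into S {w} wv = frontRank-< S (<ᵇ-true⇒< (proj₂ (∧-true {adj G w _} wv)))

  frontOrientation-within : ∀ S {w v} → w ∈ S → v ∈ S → adj G w v ≡ true → toℕ w < toℕ v →
                            arc (frontOrientation S) w v ≡ true
  frontOrientation-within S w∈S v∈S wv w<v =
    cong₂ _∧_ wv (<⇒<ᵇ-true (subst₂ _<_ (sym (frontRank-∈ S w∈S)) (sym (frontRank-∈ S v∈S)) w<v))

module _ {n} {G : Graph n} where

  noInNeighbour⇒∈ : {D : Orientation G} {S : Subset n} {v : Fin n} → IsLocDom D S →
                    (∀ w → arc D w v ≢ true) → v ∈ S
  noInNeighbour⇒∈ {S = S} {v} (dominating , _) none with v ∈? S
  ... | yes v∈S = v∈S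
  ... | no v∉S  = let (w , _ , wv) = dominating v v∉S in contradiction wv (none w)

  α≤Γ : ∀ {Γ a} → IsOrientedGammaLD G Γ → IsIndependenceNumber G a → a ≤ Γ
  α≤Γ {a = a} OG ((I , independent , ∣I∣≡a) , _) =
    Γ-lowerBound OG (λ m → m) (λ a≤b → a≤b) (λ ¬D → ¬D (D , I≤locDom))
    where
    D : Orientation G
    D = frontOrientation G I
    source : ∀ {v} → v ∈ I → ∀ w → arc D w v ≢ true
    source v∈I w wv = contradiction
      (trans (sym (arc-edge D w _ wv)) (independent w _ (proj₁ (frontOrientation-into G I wv v∈I)) v∈I))
      λ ()
    I≤locDom : ∀ S → IsLocDom D S → a ≤ ∣ S ∣
    I≤locDom S ld = subst (_≤ ∣ S ∣) ∣I∣≡a (p⊆q⇒∣p∣≤∣q∣ (λ {v} v∈I → noInNeighbour⇒∈ {D = D} ld (source v∈I)))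

  ∣clique∣≤2∣locDom∣ : ∀ {K S} → IsClique G K → IsLocDom (frontOrientation G K) S → ∣ K ∣ ≤ ∣ S ∣ + ∣ S ∣
  ∣clique∣≤2∣locDom∣ {K} {S} clique (dominating , locating) = begin
    ∣ K ∣                         ≡⟨ ∣p∣≡count K ⟩
    count (_∈? K)                 ≡⟨ count-split (_∈? K) (_∈? S) ⟩
    count K∩S? + count K∖S?       ≤⟨ +-monoʳ-≤ (count K∩S?) K∖S≤K∩S ⟩
    count K∩S? + count K∩S?       ≤⟨ +-mono-≤ K∩S≤S K∩S≤S ⟩
    ∣ S ∣ + ∣ S ∣                 ∎
    where
    open ≤-Reasoning
    D = frontOrientation G K
    K∩S? : ∀ i → Dec (i ∈ K × i ∈ S)
    K∩S? i = (i ∈? K) ×-dec (i ∈? S)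
    K∖S? : ∀ i → Dec (i ∈ K × i ∉ S)
    K∖S? i = (i ∈? K) ×-dec ¬? (i ∈? S)
    K∩S≤S : count K∩S? ≤ ∣ S ∣
    K∩S≤S = subst (count K∩S? ≤_) (sym (∣p∣≡count S)) (count-mono K∩S? (_∈? S) (λ _ → proj₂))
    below : ∀ a → a ∈ K × a ∉ S → ∃[ t ] ((t ∈ K × t ∈ S) × toℕ t < toℕ a)
    below a (a∈K , a∉S) =
      let (w , w∈S , wa) = dominating a a∉S
          (w∈K , w<a)   = frontOrientation-into G K wa a∈K
      in w , (w∈K , w∈S) , w<a
    arc-into : ∀ {x v} → x ∈ K → x ∈ S → v ∈ K → v ∉ S → toℕ x < toℕ v → arc D x v ≡ true
    arc-into {x} {v} x∈K x∈S v∈K v∉S x<v =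
      frontOrientation-within G K x∈K v∈K (clique x v x∈K v∈K λ { refl → v∉S x∈S }) x<v
    between : ∀ a a' → a ∈ K × a ∉ S → a' ∈ K × a' ∉ S → toℕ a < toℕ a' →
              ∃[ t ] ((t ∈ K × t ∈ S) × toℕ a ≤ toℕ t × toℕ t < toℕ a')
    between a a' (a∈K , a∉S) (a'∈K , a'∉S) a<a' with locating a a' a∉S a'∉S (<⇒≢ a<a' ∘ cong toℕ)
    ... | x , x∈S , separates with Bool-≢ separates
    ... | inj₁ (xa , xa'≡false) =
      let (x∈K , x<a) = frontOrientation-into G K xa a∈K in
      contradiction (trans (sym xa'≡false) (arc-into x∈K x∈S a'∈K a'∉S (<-trans x<a a<a'))) λ ()
    ... | inj₂ (xa≡false , xa') =
      let (x∈K , x<a') = frontOrientation-into G K xa' a'∈K in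
      x , (x∈K , x∈S) , ≮⇒≥ (λ x<a → contradiction (trans (sym xa≡false) (arc-into x∈K x∈S a∈K a∉S x<a)) λ ()) , x<a'
    K∖S≤K∩S : count K∖S? ≤ count K∩S?
    K∖S≤K∩S = count-≤-interleaved K∖S? K∩S? below between

⌈half⌉≤ : ∀ {w s} → w ≤ s + s → (w + 1) / 2 ≤ s
⌈half⌉≤ {w} {s} w≤2s = ≤-pred (m<n*o⇒m/o<n (begin-strict
  w + 1                ≡⟨ +-comm w 1 ⟩
  suc w                <⟨ s≤s (s≤s w≤2s) ⟩
  suc (suc (s + s))    ≡⟨ cong (suc ∘ suc) (trans (cong (s +_) (sym (+-identityʳ s))) (*-comm 2 s)) ⟩
  suc s * 2            ∎))
  where open ≤-Reasoning

⌈ω/2⌉≤Γ : ∀ {n} {G : Graph n} {Γ w} → IsOrientedGammaLD G Γ → IsCliqueNumber G w → (w + 1) / 2 ≤ Γ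
⌈ω/2⌉≤Γ {G = G} OG ((K , clique , ∣K∣≡w) , _) = Γ-lowerBound OG (λ m → m) (λ a≤b → a≤b) λ ¬D →
  ¬D (frontOrientation G K , λ S ld → ⌈half⌉≤ (subst (_≤ ∣ S ∣ + ∣ S ∣) ∣K∣≡w (∣clique∣≤2∣locDom∣ {G = G} clique ld)))

module _ {n} {G : Graph n} where

  outdeg : Orientation G → Fin n → ℕ
  outdeg D u = ∑[ v < n ] 𝟙 (arc D u v)

  module _ {D : Orientation G} {S : Subset n} where

    InNeighbour : Fin n → Fin n → Set
    InNeighbour v w = w ∈ S × arc D w v ≡ true

    InNeighbour? : ∀ v w → Dec (InNeighbour v w)
    InNeighbour? v w = (w ∈? S) ×-dec (arc D w v Bool.≟ true)

    inDeg : Fin n → ℕ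
    inDeg v = count (InNeighbour? v)

    ∑inDeg≤k∣S∣ : ∀ {k} → (∀ u → outdeg D u ≤ k) → ∑[ v < n ] inDeg v ≤ k * ∣ S ∣
    ∑inDeg≤k∣S∣ {k} outdeg≤k = begin
      ∑[ v < n ] ∑[ w < n ] ⟦ InNeighbour? v w ⟧   ≡⟨ ∑-comm (λ v w → ⟦ InNeighbour? v w ⟧) ⟩
      ∑[ w < n ] ∑[ v < n ] ⟦ InNeighbour? v w ⟧   ≤⟨ sum-mono-≤ outNeighbours≤ ⟩
      ∑[ w < n ] (k * ⟦ w ∈? S ⟧)                  ≡⟨ sym (*-distribˡ-sum k (λ w → ⟦ w ∈? S ⟧)) ⟩
      k * count (_∈? S)                            ≡⟨ cong (k *_) (sym (∣p∣≡count S)) ⟩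
      k * ∣ S ∣                                    ∎
      where
      open ≤-Reasoning
      outNeighbours≤ : ∀ w → ∑[ v < n ] ⟦ InNeighbour? v w ⟧ ≤ k * ⟦ w ∈? S ⟧
      outNeighbours≤ w with w ∈? S
      ... | no _  = ≤-reflexive (trans (sum-zero {n} (λ _ → refl)) (sym (*-zeroʳ k)))
      ... | yes _ = begin
        ∑[ v < n ] ⟦ arc D w v Bool.≟ true ⟧  ≡⟨ sum-cong-≗ (λ v → 𝟙≟true (arc D w v)) ⟩
        outdeg D w                           ≤⟨ outdeg≤k w ⟩
        k                                    ≡⟨ sym (*-identityʳ k) ⟩
        k * 1                                ∎
        where
        𝟙≟true : ∀ b → ⟦ b Bool.≟ true ⟧ ≡ 𝟙 b
        𝟙≟true true  = refl
        𝟙≟true false = refl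

    UniquelyDominated : Fin n → Set
    UniquelyDominated v = v ∉ S × inDeg v ≡ 1

    UniquelyDominated? : ∀ v → Dec (UniquelyDominated v)
    UniquelyDominated? v = ¬? (v ∈? S) ×-dec (inDeg v ≟ℕ 1)

    count-uniquelyDominated≤∣S∣ : IsLocDom D S → count UniquelyDominated? ≤ ∣ S ∣
    count-uniquelyDominated≤∣S∣ ld = subst (count UniquelyDominated? ≤_) (sym (∣p∣≡count S))
      (count-≤-matching UniquelyDominated? (_∈? S) (λ v w → UniquelyDominated? v ×-dec InNeighbour? v w)
        (λ v ud@(v∉S , _) → let (w , w∈S , wv) = proj₁ ld v v∉S in w , ud , w∈S , wv)
        (λ _ _ (_ , w∈S , _) → w∈S)
        sameDominator)
      where
      onlyDominator : ∀ {v w x} → UniquelyDominated v → InNeighbour v w → InNeighbour v x → x ≡ w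
      onlyDominator {v} (_ , inDeg≡1) wv xv = count≤1⇒unique (InNeighbour? v) (≤-reflexive inDeg≡1) xv wv
      sameDominator : ∀ v v' w → UniquelyDominated v × InNeighbour v w →
                      UniquelyDominated v' × InNeighbour v' w → v ≡ v'
      sameDominator v v' w (ud , w∈S , wv) (ud' , _ , wv') with v Fin.≟ v'
      ... | yes v≡v' = v≡v'
      ... | no v≢v' with proj₂ ld v v' (proj₁ ud) (proj₁ ud') v≢v'
      ...   | x , x∈S , separates with Bool-≢ separates
      ...     | inj₁ (xv , xv'≡false) rewrite onlyDominator ud (w∈S , wv) (x∈S , xv) =
                contradiction (trans (sym xv'≡false) wv') λ ()
      ...     | inj₂ (xv≡false , xv') rewrite onlyDominator ud' (w∈S , wv') (x∈S , xv') =
                contradiction (trans (sym xv≡false) wv) λ ()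

    outside≤inDeg : IsLocDom D S → ∀ v → 2 * ⟦ ¬? (v ∈? S) ⟧ ≤ inDeg v + ⟦ UniquelyDominated? v ⟧
    outside≤inDeg ld v = byMembership (v ∈? S)
      where
      twice≤ : v ∉ S → Dec (inDeg v ≡ 1) → 2 ≤ inDeg v + ⟦ UniquelyDominated? v ⟧
      twice≤ v∉S (yes inDeg≡1) =
        ≤-reflexive (sym (cong₂ _+_ inDeg≡1 (⟦yes⟧ (UniquelyDominated? v) (v∉S , inDeg≡1))))
      twice≤ v∉S (no inDeg≢1) =
        let (w , w∈S , wv) = proj₁ ld v v∉S in
        ≤-trans (≤∧≢⇒< (count≥1 (InNeighbour? v) w (w∈S , wv)) (inDeg≢1 ∘ sym)) (m≤m+n (inDeg v) _)
      byMembership : Dec (v ∈ S) → 2 * ⟦ ¬? (v ∈? S) ⟧ ≤ inDeg v + ⟦ UniquelyDominated? v ⟧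
      byMembership (yes v∈S) rewrite ⟦no⟧ (¬? (v ∈? S)) (λ v∉S → v∉S v∈S) = z≤n
      byMembership (no v∉S)  rewrite ⟦yes⟧ (¬? (v ∈? S)) v∉S = twice≤ v∉S (inDeg v ≟ℕ 1)

    locDom-size : ∀ {k} → IsLocDom D S → (∀ u → outdeg D u ≤ k) → 2 * n ≤ ∣ S ∣ * (k + 3)
    locDom-size {k} ld outdeg≤k = begin
      2 * n                                   ≡⟨ cong (2 *_) (sym n≡∣S∣+outside) ⟩
      2 * (∣ S ∣ + outside)                   ≡⟨ *-distribˡ-+ 2 ∣ S ∣ outside ⟩
      2 * ∣ S ∣ + 2 * outside                 ≤⟨ +-monoʳ-≤ (2 * ∣ S ∣) 2outside≤ ⟩
      2 * ∣ S ∣ + (k * ∣ S ∣ + ∣ S ∣)         ≡⟨ arith ∣ S ∣ k ⟩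
      ∣ S ∣ * (k + 3)                         ∎
      where
      open ≤-Reasoning
      outside = count (λ v → ¬? (v ∈? S))
      n≡∣S∣+outside : ∣ S ∣ + outside ≡ n
      n≡∣S∣+outside = trans (cong (_+ outside) (∣p∣≡count S)) (count+count-complement (_∈? S))
      arith : ∀ s k → 2 * s + (k * s + s) ≡ s * (k + 3)
      arith = solve-∀
      2outside≤ : 2 * outside ≤ k * ∣ S ∣ + ∣ S ∣
      2outside≤ = begin
        2 * outside                                        ≡⟨ *-distribˡ-sum 2 (λ v → ⟦ ¬? (v ∈? S) ⟧) ⟩
        ∑[ v < n ] (2 * ⟦ ¬? (v ∈? S) ⟧)                  ≤⟨ sum-mono-≤ (outside≤inDeg ld) ⟩
        ∑[ v < n ] (inDeg v + ⟦ UniquelyDominated? v ⟧)    ≡⟨ ∑-distrib-+ inDeg (λ v → ⟦ UniquelyDominated? v ⟧) ⟩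
        ∑[ v < n ] inDeg v + count UniquelyDominated?      ≤⟨ +-mono-≤ (∑inDeg≤k∣S∣ outdeg≤k) (count-uniquelyDominated≤∣S∣ ld) ⟩
        k * ∣ S ∣ + ∣ S ∣                                  ∎

module _ {n} {G : Graph n} (D : Orientation G) {a x : Fin n} (ax : arc D a x ≡ true) where

  private
    OnPair : Fin n → Fin n → Set
    OnPair p q = (p ≡ a × q ≡ x) ⊎ (p ≡ x × q ≡ a)

    onPair? : ∀ p q → Dec (OnPair p q)
    onPair? p q = ((p ≟ a) ×-dec (q ≟ x)) ⊎-dec ((p ≟ x) ×-dec (q ≟ a))

    OnPair-sym : ∀ {p q} → OnPair p q → OnPair q p
    OnPair-sym (inj₁ (p≡a , q≡x)) = inj₂ (q≡x , p≡a)
    OnPair-sym (inj₂ (p≡x , q≡a)) = inj₁ (q≡a , p≡x)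

    xa≡false : arc D x a ≡ false
    xa≡false with arc D x a in xa
    ... | true  = contradiction (ax , xa) (one-dir D a x)
    ... | false = refl

    a≢x : a ≢ x
    a≢x = adj⇒≢ G (arc-edge D a x ax)

    reversedArc : Fin n → Fin n → Bool
    reversedArc p q = if does (onPair? p q) then arc D q p else arc D p q

    reversedArc-on : ∀ {p q} → OnPair p q → reversedArc p q ≡ arc D q p
    reversedArc-on {p} {q} on = cong (λ b → if b then arc D q p else arc D p q) (dec-true (onPair? p q) on)

    reversedArc-off : ∀ {p q} → ¬ OnPair p q → reversedArc p q ≡ arc D p q
    reversedArc-off {p} {q} off = cong (λ b → if b then arc D q p else arc D p q) (dec-false (onPair? p q) off)

  reverseArc : Orientation G
  reverseArc = record { arc = reversedArc ; arc-edge = arc-edge′ ; edge-arc = edge-arc′ ; one-dir = one-dir′ }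
    where
    arc-edge′ : ∀ p q → reversedArc p q ≡ true → adj G p q ≡ true
    arc-edge′ p q pq with onPair? p q
    ... | yes on = trans (adj-sym G p q) (arc-edge D q p (trans (sym (reversedArc-on on)) pq))
    ... | no off = arc-edge D p q (trans (sym (reversedArc-off off)) pq)
    edge-arc′ : ∀ p q → adj G p q ≡ true → (reversedArc p q ≡ true) ⊎ (reversedArc q p ≡ true)
    edge-arc′ p q pq with onPair? p q
    ... | yes on with edge-arc D q p (trans (adj-sym G q p) pq)
    ...   | inj₁ qp = inj₁ (trans (reversedArc-on on) qp)
    ...   | inj₂ pq′ = inj₂ (trans (reversedArc-on (OnPair-sym on)) pq′)
    edge-arc′ p q pq | no off with edge-arc D p q pq
    ...   | inj₁ pq′ = inj₁ (trans (reversedArc-off off) pq′)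
    ...   | inj₂ qp = inj₂ (trans (reversedArc-off (off ∘ OnPair-sym)) qp)
    one-dir′ : ∀ p q → ¬ ((reversedArc p q ≡ true) × (reversedArc q p ≡ true))
    one-dir′ p q (pq , qp) with onPair? p q
    ... | yes on = one-dir D q p (trans (sym (reversedArc-on on)) pq ,
                                  trans (sym (reversedArc-on (OnPair-sym on))) qp)
    ... | no off = one-dir D p q (trans (sym (reversedArc-off off)) pq ,
                                  trans (sym (reversedArc-off (off ∘ OnPair-sym))) qp)

  reverseArc-unchanged : ∀ {z} → z ≢ a → z ≢ x → ∀ y →
                         arc reverseArc z y ≡ arc D z y × arc reverseArc y z ≡ arc D y z
  reverseArc-unchanged {z} z≢a z≢x y =
    reversedArc-off [ z≢a ∘ proj₁ , z≢x ∘ proj₁ ]′ , reversedArc-off [ z≢x ∘ proj₂ , z≢a ∘ proj₂ ]′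

  reverseArc-outdeg : ∀ z → outdeg reverseArc z + ⟦ z ≟ a ⟧ ≡ outdeg D z + ⟦ z ≟ x ⟧
  reverseArc-outdeg z = begin
    outdeg reverseArc z + ⟦ z ≟ a ⟧                                     ≡⟨ cong (outdeg reverseArc z +_) (pick a x) ⟩
    outdeg reverseArc z + ∑[ q < n ] (⟦ z ≟ a ⟧ * ⟦ q ≟ x ⟧)           ≡⟨ sym (∑-distrib-+ _ (λ q → ⟦ z ≟ a ⟧ * ⟦ q ≟ x ⟧)) ⟩
    ∑[ q < n ] (𝟙 (reversedArc z q) + ⟦ z ≟ a ⟧ * ⟦ q ≟ x ⟧)          ≡⟨ sum-cong-≗ pointwise ⟩
    ∑[ q < n ] (𝟙 (arc D z q) + ⟦ z ≟ x ⟧ * ⟦ q ≟ a ⟧)                ≡⟨ ∑-distrib-+ _ (λ q → ⟦ z ≟ x ⟧ * ⟦ q ≟ a ⟧) ⟩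
    outdeg D z + ∑[ q < n ] (⟦ z ≟ x ⟧ * ⟦ q ≟ a ⟧)                    ≡⟨ cong (outdeg D z +_) (sym (pick x a)) ⟩
    outdeg D z + ⟦ z ≟ x ⟧                                              ∎
    where
    open ≡-Reasoning
    pick : ∀ p q → ⟦ z ≟ p ⟧ ≡ ∑[ i < n ] (⟦ z ≟ p ⟧ * ⟦ i ≟ q ⟧)
    pick p q = begin
      ⟦ z ≟ p ⟧                        ≡⟨ sym (*-identityʳ _) ⟩
      ⟦ z ≟ p ⟧ * 1                    ≡⟨ cong (⟦ z ≟ p ⟧ *_) (sym (count-≟ q)) ⟩
      ⟦ z ≟ p ⟧ * count (_≟ q)         ≡⟨ *-distribˡ-sum ⟦ z ≟ p ⟧ (λ i → ⟦ i ≟ q ⟧) ⟩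
      ∑[ i < n ] (⟦ z ≟ p ⟧ * ⟦ i ≟ q ⟧) ∎
    off-pair : ∀ {p q p' q'} → ¬ (p ≡ p' × q ≡ q') → ⟦ p ≟ p' ⟧ * ⟦ q ≟ q' ⟧ ≡ 0
    off-pair {p} {q} {p'} {q'} ne with p ≟ p' | q ≟ q'
    ... | yes p≡p' | yes q≡q' = contradiction (p≡p' , q≡q') ne
    ... | yes _    | no _     = refl
    ... | no _     | _        = refl
    pointwise : ∀ q → 𝟙 (reversedArc z q) + ⟦ z ≟ a ⟧ * ⟦ q ≟ x ⟧ ≡ 𝟙 (arc D z q) + ⟦ z ≟ x ⟧ * ⟦ q ≟ a ⟧
    pointwise q with onPair? z q
    ... | yes on@(inj₁ (refl , refl)) rewrite reversedArc-on on | xa≡false | ax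
      | dec-true (z ≟ z) refl | dec-true (q ≟ q) refl | dec-false (z ≟ q) a≢x = refl
    ... | yes on@(inj₂ (refl , refl)) rewrite reversedArc-on on | xa≡false | ax
      | dec-true (z ≟ z) refl | dec-true (q ≟ q) refl | dec-false (z ≟ q) (a≢x ∘ sym) = refl
    ... | no off = cong₂ _+_ (cong 𝟙 (reversedArc-off off))
                             (trans (off-pair (off ∘ inj₁)) (sym (off-pair (off ∘ inj₂))))

module _ {n} {G : Graph n} where

  data Walk (D : Orientation G) : Fin n → Fin n → ℕ → Set where
    []  : ∀ {a} → Walk D a a 0
    _∷_ : ∀ {a b c L} → arc D a b ≡ true → Walk D b c L → Walk D a c (suc L)

  _∷ʳ_ : ∀ {D a b c L} → Walk D a b L → arc D b c ≡ true → Walk D a c (suc L)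
  []       ∷ʳ bc = bc ∷ []
  (ab ∷ w) ∷ʳ bc = ab ∷ (w ∷ʳ bc)

  NoWalkWithin : Orientation G → Fin n → Fin n → ℕ → Set
  NoWalkWithin D z b L = ∀ L' → L' ≤ L → ¬ Walk D z b L'

  record WalkReversal (D : Orientation G) (a b : Fin n) (L : ℕ) : Set where
    field
      reversed     : Orientation G
      outdeg-shift : ∀ z → outdeg reversed z + ⟦ z ≟ a ⟧ ≡ outdeg D z + ⟦ z ≟ b ⟧
      unchanged    : ∀ z y → NoWalkWithin D z b L →
                     arc reversed z y ≡ arc D z y × arc reversed y z ≡ arc D y z
  open WalkReversal

  -- Reverse the tail first: a shortest walk does not revisit its start, so its first arc survives.
  reverseShortestWalk : ∀ {D a b L} → Walk D a b L → (∀ L' → L' < L → ¬ Walk D a b L') → WalkReversal D a b L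
  reverseShortestWalk {D} [] _ = record { reversed = D ; outdeg-shift = λ _ → refl ; unchanged = λ _ _ _ → refl , refl }
  reverseShortestWalk {D} {a} {b} (_∷_ {b = x} {L = L} ax w) shortest = record
    { reversed     = reverseArc D′ ax′
    ; outdeg-shift = λ z → trans (reverseArc-outdeg D′ ax′ z) (outdeg-shift tail z)
    ; unchanged    = unchanged′
    }
    where
    tail : WalkReversal D x b L
    tail = reverseShortestWalk w (λ L' L'<L w' → shortest (suc L') (s≤s L'<L) (ax ∷ w'))
    D′ = reversed tail
    ax′ : arc D′ a x ≡ true
    ax′ = trans (proj₁ (unchanged tail a x (λ L' L'≤L → shortest L' (s≤s L'≤L)))) ax
    unchanged′ : ∀ z y → NoWalkWithin D z b (suc L) →
                 arc (reverseArc D′ ax′) z y ≡ arc D z y × arc (reverseArc D′ ax′) y z ≡ arc D y z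
    unchanged′ z y far =
      let (zy′ , yz′) = reverseArc-unchanged D′ ax′ z≢a z≢x y
          (zy , yz)   = unchanged tail z y (λ L' L'≤L → far L' (m≤n⇒m≤1+n L'≤L))
      in trans zy′ zy , trans yz′ yz
      where
      z≢a : z ≢ a
      z≢a refl = far (suc L) ≤-refl (ax ∷ w)
      z≢x : z ≢ x
      z≢x refl = far L (n≤1+n L) w

module _ {n} (G : Graph n) where

  private
    _<ᶠ_ : Fin n → Fin n → Bool
    i <ᶠ j = toℕ i <ᵇ toℕ j

  edgeCount≡∑∑ : (E : Fin n → Fin n → Bool) → edgeCount E ≡ ∑[ i < n ] ∑[ j < n ] 𝟙 (i <ᶠ j ∧ E i j)
  edgeCount≡∑∑ E = trans (sum-map-allFin (λ i → List.sum (List.map (λ j → 𝟙 (i <ᶠ j ∧ E i j)) (List.allFin n))))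
                         (sum-cong-≗ (λ i → sum-map-allFin (λ j → 𝟙 (i <ᶠ j ∧ E i j))))

  inside : Subset n → Fin n → Fin n → Bool
  inside R p q = does (p ∈? R) ∧ does (q ∈? R)

  induced : Subset n → Fin n → Fin n → Bool
  induced R p q = adj G p q ∧ inside R p q

  induced-isSubgraph : ∀ R → IsSubgraph G R (induced R)
  induced-isSubgraph R =
    (λ p q → cong₂ _∧_ (adj-sym G p q) (∧-comm (does (p ∈? R)) _)) ,
    (λ p q pq → let (adj-pq , pq∈R) = ∧-true {adj G p q} pq
                    (p∈R , q∈R)     = ∧-true {does (p ∈? R)} pq∈R
                in adj-pq , does⇒ (p ∈? R) p∈R , does⇒ (q ∈? R) q∈R)

  arc+reverseArc : ∀ (D : Orientation G) i j → 𝟙 (arc D i j) + 𝟙 (arc D j i) ≡ 𝟙 (adj G i j)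
  arc+reverseArc D i j with arc D i j in ij | arc D j i in ji
  ... | true  | true  = contradiction (ij , ji) (one-dir D i j)
  ... | true  | false = cong 𝟙 (sym (arc-edge D i j ij))
  ... | false | true  = cong 𝟙 (sym (trans (adj-sym G i j) (arc-edge D j i ji)))
  ... | false | false with adj G i j in e
  ...   | false = refl
  ...   | true  = contradiction (edge-arc D i j e) [ (λ ()) ∘ trans (sym ij) , (λ ()) ∘ trans (sym ji) ]′

  -- Each edge inside R is seen once as an arc inside R; splitting the arcs by the order of their
  -- ends and transposing the backward ones pairs them up with the edges i < j.
  arcsInside≡edgeCount : ∀ (D : Orientation G) R →
    ∑[ i < n ] ∑[ j < n ] 𝟙 (arc D i j ∧ inside R i j) ≡ edgeCount (induced R)
  arcsInside≡edgeCount D R = begin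
    ∑[ i < n ] ∑[ j < n ] 𝟙 (A i j)                                       ≡⟨ sum-cong-≗ (λ i → sum-cong-≗ (split i)) ⟩
    ∑[ i < n ] ∑[ j < n ] (𝟙 (i <ᶠ j ∧ A i j) + 𝟙 (j <ᶠ i ∧ A i j))         ≡⟨ ∑∑-distrib-+ forward backward ⟩
    ∑[ i < n ] ∑[ j < n ] 𝟙 (i <ᶠ j ∧ A i j) + ∑[ i < n ] ∑[ j < n ] 𝟙 (j <ᶠ i ∧ A i j)
      ≡⟨ cong (∑[ i < n ] ∑[ j < n ] 𝟙 (i <ᶠ j ∧ A i j) +_) (∑-comm (λ i j → 𝟙 (j <ᶠ i ∧ A i j))) ⟩
    ∑[ i < n ] ∑[ j < n ] 𝟙 (i <ᶠ j ∧ A i j) + ∑[ i < n ] ∑[ j < n ] 𝟙 (i <ᶠ j ∧ A j i)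
      ≡⟨ sym (∑∑-distrib-+ forward (λ i j → backward j i)) ⟩
    ∑[ i < n ] ∑[ j < n ] (𝟙 (i <ᶠ j ∧ A i j) + 𝟙 (i <ᶠ j ∧ A j i))         ≡⟨ sum-cong-≗ (λ i → sum-cong-≗ (merge i)) ⟩
    ∑[ i < n ] ∑[ j < n ] 𝟙 (i <ᶠ j ∧ induced R i j)                       ≡⟨ sym (edgeCount≡∑∑ (induced R)) ⟩
    edgeCount (induced R)                                                 ∎
    where
    open ≡-Reasoning
    A : Fin n → Fin n → Bool
    A i j = arc D i j ∧ inside R i j
    forward backward : Fin n → Fin n → ℕ
    forward  i j = 𝟙 (i <ᶠ j ∧ A i j)
    backward i j = 𝟙 (j <ᶠ i ∧ A i j)
    split : ∀ i j → 𝟙 (A i j) ≡ 𝟙 (i <ᶠ j ∧ A i j) + 𝟙 (j <ᶠ i ∧ A i j)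
    split i j with A i j in aij
    ... | false rewrite ∧-zeroʳ (i <ᶠ j) | ∧-zeroʳ (j <ᶠ i) = refl
    ... | true  rewrite ∧-identityʳ (i <ᶠ j) | ∧-identityʳ (j <ᶠ i)
                      | <ᵇ-flip (adj⇒≢ G (arc-edge D i j (proj₁ (∧-true {arc D i j} aij))) ∘ Fin.toℕ-injective)
                      with i <ᶠ j
    ...   | true  = refl
    ...   | false = refl
    merge : ∀ i j → 𝟙 (i <ᶠ j ∧ A i j) + 𝟙 (i <ᶠ j ∧ A j i) ≡ 𝟙 (i <ᶠ j ∧ induced R i j)
    merge i j rewrite ∧-comm (does (j ∈? R)) (does (i ∈? R)) =
      𝟙-merge (i <ᶠ j) (inside R i j) {arc D i j} {arc D j i} (arc+reverseArc D i j)

  ∑outdeg-closed : ∀ {D R} → (∀ {i j} → i ∈ R → arc D i j ≡ true → j ∈ R) →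
                   ∑[ i < n ] (⟦ i ∈? R ⟧ * outdeg D i) ≡ edgeCount (induced R)
  ∑outdeg-closed {D} {R} closed =
    trans (sum-cong-≗ {n} (λ i → trans (*-distribˡ-sum ⟦ i ∈? R ⟧ (λ j → 𝟙 (arc D i j))) (sum-cong-≗ (pointwise i))))
          (arcsInside≡edgeCount D R)
    where
    pointwise : ∀ i j → ⟦ i ∈? R ⟧ * 𝟙 (arc D i j) ≡ 𝟙 (arc D i j ∧ inside R i j)
    pointwise i j with i ∈? R
    ... | no _ rewrite ∧-zeroʳ (arc D i j) = refl
    ... | yes i∈R with arc D i j in ij
    ...   | false = refl
    ...   | true  rewrite dec-true (j ∈? R) (closed i∈R ij) = refl

DensityAtMost : ∀ {n} → Graph n → ℕ → Set
DensityAtMost G k = ∀ S E → IsSubgraph G S E → 1 ≤ ∣ S ∣ → edgeCount E ≤ k * ∣ S ∣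

module _ {n} {G : Graph n} (k : ℕ) where

  excess : Orientation G → ℕ
  excess D = ∑[ z < n ] (outdeg D z ∸ k)

  -- Reversing a walk from a vertex of out-degree > k to one of out-degree < k moves one unit
  -- of out-degree from the former to the latter and leaves all other out-degrees unchanged.
  excess-reversal< : ∀ {D u v L} → k < outdeg D u → outdeg D v < k → (rev : WalkReversal D u v L) →
                     excess (WalkReversal.reversed rev) < excess D
  excess-reversal< {D} {u} {v} {L} u-large v-small rev = begin-strict
    excess D′                           <⟨ n<1+n _ ⟩
    suc (excess D′)                     ≡⟨ +-comm 1 (excess D′) ⟩
    excess D′ + 1                       ≡⟨ cong (excess D′ +_) (sym (count-≟ u)) ⟩
    excess D′ + count (_≟ u)            ≡⟨ sym (∑-distrib-+ (λ z → outdeg D′ z ∸ k) (λ z → ⟦ z ≟ u ⟧)) ⟩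
    ∑[ z < n ] (outdeg D′ z ∸ k + ⟦ z ≟ u ⟧) ≡⟨ sum-cong-≗ (λ z → pointwise z (WalkReversal.outdeg-shift rev z)) ⟩
    excess D                            ∎
    where
    open ≤-Reasoning
    D′ = WalkReversal.reversed rev
    pointwise : ∀ z → outdeg D′ z + ⟦ z ≟ u ⟧ ≡ outdeg D z + ⟦ z ≟ v ⟧ →
                outdeg D′ z ∸ k + ⟦ z ≟ u ⟧ ≡ outdeg D z ∸ k
    pointwise z shift with z ≟ u | z ≟ v
    ... | yes refl | yes refl = contradiction u-large (<-asym v-small)
    ... | yes refl | no _     = begin-equality
      outdeg D′ z ∸ k + 1   ≡⟨ sym (+-∸-comm 1 (≤-pred (subst (k <_) (trans (sym shift′) (+-comm _ 1)) u-large))) ⟩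
      outdeg D′ z + 1 ∸ k   ≡⟨ cong (_∸ k) shift′ ⟩
      outdeg D z ∸ k        ∎
      where
      shift′ : outdeg D′ z + 1 ≡ outdeg D z
      shift′ = trans shift (+-identityʳ _)
    ... | no _     | yes refl = begin-equality
      outdeg D′ z ∸ k + 0   ≡⟨ +-identityʳ _ ⟩
      outdeg D′ z ∸ k       ≡⟨ m≤n⇒m∸n≡0 (subst (_≤ k) (sym shift′) (subst (_≤ k) (+-comm 1 _) v-small)) ⟩
      0                     ≡⟨ sym (m≤n⇒m∸n≡0 (<⇒≤ v-small)) ⟩
      outdeg D z ∸ k        ∎
      where
      shift′ : outdeg D′ z ≡ outdeg D z + 1
      shift′ = trans (sym (+-identityʳ _)) shift
    ... | no _     | no _     = trans (+-identityʳ _) (cong (_∸ k) (+-cancelʳ-≡ 0 _ _ shift))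

  module _ (sparse : DensityAtMost G k) where

    -- A set closed under out-arcs has average out-degree at most k, so it cannot contain a vertex
    -- of out-degree > k while all its vertices have out-degree ≥ k.
    closed-notAllLarge : ∀ {D : Orientation G} {R u} → (∀ {i j} → i ∈ R → arc D i j ≡ true → j ∈ R) → u ∈ R →
                         k < outdeg D u → ¬ (∀ i → i ∈ R → k ≤ outdeg D i)
    closed-notAllLarge {D} {R} {u} closed u∈R u-large allLarge = <⇒≱ k∣R∣<edges edges≤k∣R∣
      where
      edges≤k∣R∣ : edgeCount (induced G R) ≤ k * ∣ R ∣
      edges≤k∣R∣ = sparse R (induced G R) (induced-isSubgraph G R)
                     (subst (1 ≤_) (sym (∣p∣≡count R)) (count≥1 (_∈? R) u u∈R))
      pointwise : ∀ i → k * ⟦ i ∈? R ⟧ + ⟦ i ≟ u ⟧ ≤ ⟦ i ∈? R ⟧ * outdeg D i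
      pointwise i with i ∈? R | i ≟ u
      ... | yes _   | yes refl rewrite *-identityʳ k | *-identityˡ (outdeg D u) = subst (_≤ outdeg D u) (+-comm 1 k) u-large
      ... | yes i∈R | no _     rewrite *-identityʳ k | *-identityˡ (outdeg D i) | +-identityʳ k = allLarge i i∈R
      ... | no i∉R  | yes refl = contradiction u∈R i∉R
      ... | no _    | no _     rewrite *-zeroʳ k = z≤n
      k∣R∣<edges : k * ∣ R ∣ < edgeCount (induced G R)
      k∣R∣<edges = begin-strict
        k * ∣ R ∣                                       <⟨ n<1+n _ ⟩
        suc (k * ∣ R ∣)                                 ≡⟨ +-comm 1 _ ⟩
        k * ∣ R ∣ + 1                                   ≡⟨ cong₂ _+_ (cong (k *_) (∣p∣≡count R)) (sym (count-≟ u)) ⟩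
        k * count (_∈? R) + count (_≟ u)                ≡⟨ cong (_+ count (_≟ u)) (*-distribˡ-sum k (λ i → ⟦ i ∈? R ⟧)) ⟩
        ∑[ i < n ] (k * ⟦ i ∈? R ⟧) + count (_≟ u)      ≡⟨ sym (∑-distrib-+ (λ i → k * ⟦ i ∈? R ⟧) (λ i → ⟦ i ≟ u ⟧)) ⟩
        ∑[ i < n ] (k * ⟦ i ∈? R ⟧ + ⟦ i ≟ u ⟧)         ≤⟨ sum-mono-≤ pointwise ⟩
        ∑[ i < n ] (⟦ i ∈? R ⟧ * outdeg D i)             ≡⟨ ∑outdeg-closed G {D} {R} closed ⟩
        edgeCount (induced G R)                           ∎
        where open ≤-Reasoning

    -- If outdeg u > k, either a vertex of out-degree < k is reachable from u (and reversing a
    -- shortest walk to it lowers the excess), or the vertices reachable from u form a closed set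
    -- contradicting closed-notAllLarge.
    minimalExcess⇒outdeg≤ : ∀ D → (∀ D' → ¬ excess D' < excess D) → ∀ u → outdeg D u ≤ k
    minimalExcess⇒outdeg≤ D minimal u = decidable-stable (outdeg D u ≤? k) λ u≰k →
      ¬¬-excluded-middle {A = ∃[ L ] SmallAt L} (byReachability (≰⇒> u≰k))
      where
      SmallAt : ℕ → Set
      SmallAt L = ∃[ v ] (Walk D u v L × outdeg D v < k)
      Reachable : Fin n → Set
      Reachable v = ∃[ L ] Walk D u v L
      byReachability : k < outdeg D u → ¬ Dec (∃[ L ] SmallAt L)
      byReachability u-large (yes (L , small)) = ¬¬-least {P = SmallAt} L small λ (L , (v , w , v-small) , shortest) →
        let rev = reverseShortestWalk w (λ L' L'<L w' → shortest L' L'<L (v , w' , v-small))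
        in minimal (WalkReversal.reversed rev) (excess-reversal< u-large v-small rev)
      byReachability u-large (no noSmall) = ¬¬-subset Reachable λ (R , R⇔Reachable) →
        closed-notAllLarge {D = D} {R = R}
          (λ i∈R ij → let (L , w) = proj₁ (R⇔Reachable _) i∈R in proj₂ (R⇔Reachable _) (suc L , w ∷ʳ ij))
          (proj₂ (R⇔Reachable u) (0 , []))
          u-large
          (λ i i∈R → let (L , w) = proj₁ (R⇔Reachable i) i∈R in ≮⇒≥ λ small → noSmall (L , i , w , small))

    hakimi : ¬ ¬ (∃[ D ] ∀ u → outdeg D u ≤ k)
    hakimi found = ¬¬-least {P = λ m → ∃[ D ] excess D ≡ m} (excess D₀) (D₀ , refl) λ (m , (D , excess≡m) , least) →
      found (D , minimalExcess⇒outdeg≤ D (λ D' D'<D → least (excess D') (subst (excess D' <_) excess≡m D'<D) (D' , refl)))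
      where
      D₀ : Orientation G
      D₀ = byRank G toℕ Fin.toℕ-injective

module _ {n} {G : Graph n} {c : ℕ} (bound : MadHalfPlus3Bound G c) where

  madBound⇒sparse : DensityAtMost G (c ∸ 3)
  madBound⇒sparse S E subgraph nonempty = subst (edgeCount E ≤_) (sym (*-distribʳ-∸ ∣ S ∣ c 3))
    (m+n≤o⇒m≤o∸n (edgeCount E) (bound S E subgraph nonempty))

  -- The edgeless spanning subgraph gives 3n ≤ cn.
  madBound⇒3≤ : 1 ≤ n → 3 ≤ c
  madBound⇒3≤ 1≤n@(s≤s _) = *-cancelʳ-≤ 3 c n (subst₂ (λ e s → e + 3 * s ≤ c * s) edgeless (∣⊤∣≡n n)
    (bound ⊤ (λ _ _ → false) ((λ _ _ → refl) , (λ _ _ ())) (subst (1 ≤_) (sym (∣⊤∣≡n n)) 1≤n)))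
    where
    edgeless : edgeCount {n} (λ _ _ → false) ≡ 0
    edgeless = trans (edgeCount≡∑∑ G (λ _ _ → false))
                     (sum-zero {n} (λ i → sum-zero {n} (λ j → cong 𝟙 (∧-zeroʳ (toℕ i <ᵇ toℕ j)))))

2n≤Γ⌈mad/2+3⌉ : ∀ {n} {G : Graph n} {Γ c} → IsOrientedGammaLD G Γ → IsCeilMadHalfPlus3 G c → 2 * n ≤ Γ * c
2n≤Γ⌈mad/2+3⌉ {zero}          _  _           = z≤n
2n≤Γ⌈mad/2+3⌉ {suc n} {G} {c = c} OG (bound , _) = Γ-lowerBound OG (_* c) (*-monoˡ-≤ c) λ ¬D →
  hakimi {G = G} (c ∸ 3) (madBound⇒sparse {G = G} {c = c} bound) λ (D , outdeg≤k) →
    ¬D (D , λ S ld → subst (λ m → 2 * suc n ≤ ∣ S ∣ * m) (m∸n+n≡m (madBound⇒3≤ {G = G} {c = c} bound (s≤s z≤n)))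
                           (locDom-size {G = G} {D = D} ld outdeg≤k))

lemma29 : (n : ℕ) (G : Graph n) (Γ : ℕ) → IsOrientedGammaLD G Γ →
            ((a : ℕ) → IsIndependenceNumber G a → a ≤ Γ) ×
            ((w : ℕ) → IsCliqueNumber G w → (w + 1) / 2 ≤ Γ) ×
            ((c : ℕ) → IsCeilMadHalfPlus3 G c → 2 * n ≤ Γ * c)
lemma29 n G Γ OG = (λ _ → α≤Γ OG) , (λ _ → ⌈ω/2⌉≤Γ OG) , (λ _ → 2n≤Γ⌈mad/2+3⌉ OG)
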